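{- Let $G$ be a graph on $n$ vertices and let $r,s$ be nonnegative integers with $r+s\leq n$ such that $G$ does not contain the complete bipartite graph $K_{r,s}$ as a (not necessarily induced) subgraph. Then $\operatorname{Z}(\overline{G})\geq n-r-s+1$.
   Context: All graphs are finite, simple and undirected. For a graph $G$, $\overline{G}$ denotes its complement: same vertex set, and two distinct vertices are adjacent in $\overline{G}$ iff they are not adjacent in $G$. $K_{r,s}$ is the complete bipartite graph with parts of sizes $r$ and $s$. Zero forcing: given an initial set $B\subseteq V(G)$ of blue vertices (all others white), the color change rule allows a blue vertex that has exactly one white neighbor to turn that neighbor blue. $B$ is a zero forcing set if repeated application of the rule eventually makes every vertex blue. The zero forcing number $\operatorname{Z}(G)$ is the minimum size of a zero forcing set of $G$. -}

module Defs where

open import Data.Nat using (ℕ; _+_; _∸_; _≥_)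
open import Data.Bool using (Bool; true; false; not; if_then_else_)
open import Data.Fin using (Fin; _≟_)
open import Data.Fin.Subset using (Subset; _∈_; ∣_∣)
open import Data.Product using (Σ; _×_; _,_)
open import Function.Definitions using (Injective)
open import Relation.Binary.PropositionalEquality using (_≡_; refl; sym)
open import Data.Empty using (⊥-elim)
open import Relation.Nullary using (¬_; yes; no)

record Graph (n : ℕ) : Set where
  field
    adj    : Fin n → Fin n → Bool
    adj-sym    : ∀ u v → adj u v ≡ adj v u
    adj-irrefl : ∀ v → adj v v ≡ false
open Graph public

complement : ∀ {n} → Graph n → Graph n
complement {n} G = record { adj = cadj ; adj-sym = csym ; adj-irrefl = cirr }
  where
  cadj : Fin n → Fin n → Bool
  cadj u v with u ≟ v
  ... | yes _ = false
  ... | no  _ = not (adj G u v)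
  csym : ∀ u v → cadj u v ≡ cadj v u
  csym u v with u ≟ v | v ≟ u
  ... | yes _ | yes _ = refl
  ... | yes p | no q = ⊥-elim (q (sym p))
  ... | no p | yes q = ⊥-elim (p (sym q))
  ... | no _ | no _ rewrite Graph.adj-sym G u v = refl
  cirr : ∀ v → cadj v v ≡ false
  cirr v with v ≟ v
  ... | yes _ = refl
  ... | no p = ⊥-elim (p refl)

ContainsKrs : ∀ {n} → Graph n → ℕ → ℕ → Set
ContainsKrs {n} G r s =
  Σ (Fin r → Fin n) λ f → Σ (Fin s → Fin n) λ g →
    Injective _≡_ _≡_ f × Injective _≡_ _≡_ g ×
    (∀ i j → ¬ (f i ≡ g j)) ×
    (∀ i j → adj G (f i) (g j) ≡ true)

-- Final coloring of zero forcing from initial blue set B: the least set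
-- containing B and closed under the color change rule (a blue vertex u
-- all of whose neighbours other than v are blue forces its neighbour v).
data Blue {n : ℕ} (G : Graph n) (B : Subset n) : Fin n → Set where
  initial : ∀ {v} → v ∈ B → Blue G B v
  force   : ∀ {u v} → Blue G B u → adj G u v ≡ true →
            (∀ w → adj G u w ≡ true → ¬ (w ≡ v) → Blue G B w) →
            Blue G B v

IsZeroForcingSet : ∀ {n} → Graph n → Subset n → Set
IsZeroForcingSet G B = ∀ v → Blue G B v

-- Z(G) ≥ k  iff every zero forcing set has at least k elements
-- (Z(G) exists since the whole vertex set is zero forcing).
ZeroForcingNumber≥ : ∀ {n} → Graph n → ℕ → Set
ZeroForcingNumber≥ {n} G k = (B : Subset n) → IsZeroForcingSet G B → ∣ B ∣ ≥ k

module Submission where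

-- Let B be a zero forcing set of the complement H of G with |B| ≤ n − r − s.
-- Follow the first r forces of a forcing process: they are performed by r
-- distinct vertices and leave a blue set of size at most |B| + r ≤ n − s.
-- A vertex that has forced is H-adjacent only to blue vertices, so in G it is
-- adjacent to all of the at least s white vertices, and G contains K_{r,s}.

open import Defs
open import Data.Nat using (ℕ; zero; suc; _+_; _∸_; _≤_; _<_; z≤n; s≤s)
import Data.Nat.Properties as ℕ
open import Data.Bool using (true; false)
import Data.Bool as Bool
open import Data.Bool.Properties using (¬-not)
open import Data.Fin using (Fin; zero; suc; inject≤)
import Data.Fin as Fin
open import Data.Fin.Properties using (any?; suc-injective; inject≤-injective)
open import Data.Fin.Subset using (Subset; inside; outside; _∈_; _∉_; _⊆_; _∪_; ⁅_⁆; ∁; ∣_∣)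
open import Data.Fin.Subset.Properties
  using (_∈?_; ⊆-refl; p⊆p∪q; q⊆p∪q; x∈⁅x⁆; ∣⁅x⁆∣≡1; ∣∁p∣≡n∸∣p∣; x∈∁p⇒x∉p)
open import Data.Vec using ([]; _∷_; here; there)
open import Data.Product using (Σ; ∃; _×_; _,_)
open import Function using (_∘_)
open import Function.Definitions using (Injective)
open import Relation.Binary.PropositionalEquality using (_≡_; _≢_; refl; sym; cong; subst)
open import Relation.Nullary using (¬_; yes; no; contradiction)
open import Relation.Nullary.Decidable using (¬?; _×-dec_; decidable-stable)

∣p∪q∣≤∣p∣+∣q∣ : ∀ {n} (p q : Subset n) → ∣ p ∪ q ∣ ≤ ∣ p ∣ + ∣ q ∣
∣p∪q∣≤∣p∣+∣q∣ []            []            = z≤n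
∣p∪q∣≤∣p∣+∣q∣ (outside ∷ p) (outside ∷ q) = ∣p∪q∣≤∣p∣+∣q∣ p q
∣p∪q∣≤∣p∣+∣q∣ (outside ∷ p) (inside  ∷ q) =
  ℕ.≤-trans (s≤s (∣p∪q∣≤∣p∣+∣q∣ p q)) (ℕ.≤-reflexive (sym (ℕ.+-suc ∣ p ∣ ∣ q ∣)))
∣p∪q∣≤∣p∣+∣q∣ (inside  ∷ p) (outside ∷ q) = s≤s (∣p∪q∣≤∣p∣+∣q∣ p q)
∣p∪q∣≤∣p∣+∣q∣ (inside  ∷ p) (inside  ∷ q) =
  s≤s (ℕ.≤-trans (∣p∪q∣≤∣p∣+∣q∣ p q) (ℕ.+-monoʳ-≤ ∣ p ∣ (ℕ.n≤1+n ∣ q ∣)))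

∣p∪⁅x⁆∣≤∣p∣+1 : ∀ {n} (p : Subset n) x → ∣ p ∪ ⁅ x ⁆ ∣ ≤ ∣ p ∣ + 1
∣p∪⁅x⁆∣≤∣p∣+1 p x =
  ℕ.≤-trans (∣p∪q∣≤∣p∣+∣q∣ p ⁅ x ⁆) (ℕ.≤-reflexive (cong (∣ p ∣ +_) (∣⁅x⁆∣≡1 x)))

members : ∀ {n} (p : Subset n) → Fin ∣ p ∣ → Fin n
members (outside ∷ p) i       = suc (members p i)
members (inside  ∷ p) zero    = zero
members (inside  ∷ p) (suc i) = suc (members p i)

members-∈ : ∀ {n} (p : Subset n) i → members p i ∈ p
members-∈ (outside ∷ p) i       = there (members-∈ p i)
members-∈ (inside  ∷ p) zero    = here
members-∈ (inside  ∷ p) (suc i) = there (members-∈ p i)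

members-injective : ∀ {n} (p : Subset n) → Injective _≡_ _≡_ (members p)
members-injective (outside ∷ p)                 eq = members-injective p (suc-injective eq)
members-injective (inside  ∷ p) {zero}  {zero}  _  = refl
members-injective (inside  ∷ p) {zero}  {suc _} ()
members-injective (inside  ∷ p) {suc _} {zero}  ()
members-injective (inside  ∷ p) {suc i} {suc j} eq =
  cong suc (members-injective p (suc-injective eq))

injectionOutside : ∀ {n s} (p : Subset n) → ∣ p ∣ + s ≤ n →
  Σ (Fin s → Fin n) λ g → Injective _≡_ _≡_ g × (∀ j → g j ∉ p)
injectionOutside {n} {s} p bound =
  g , (λ eq → inject≤-injective _ _ _ _ (members-injective (∁ p) eq)) ,
  (λ j → x∈∁p⇒x∉p (members-∈ (∁ p) _))
  where
  s≤∣∁p∣ : s ≤ ∣ ∁ p ∣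
  s≤∣∁p∣ = subst (s ≤_) (sym (∣∁p∣≡n∸∣p∣ p))
             (ℕ.m+n≤o⇒m≤o∸n s (subst (_≤ n) (ℕ.+-comm ∣ p ∣ s) bound))
  g : Fin s → Fin n
  g j = members (∁ p) (inject≤ j s≤∣∁p∣)

module _ {n} (H : Graph n) where

  record ForcingStep (S : Subset n) : Set where
    field
      forcer forced : Fin n
      forcer∈S : forcer ∈ S
      forced∉S : forced ∉ S
      forcer-adj-forced : adj H forcer forced ≡ true
      others∈S : ∀ {w} → adj H forcer w ≡ true → w ≢ forced → w ∈ S

  -- Walk back along the derivation of v to a force whose forcer lies in S and
  -- has no other neighbour outside S; any such neighbour is itself derived earlier.
  forcingStep : ∀ {B S v} → B ⊆ S → Blue H B v → v ∉ S → ForcingStep S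
  forcingStep B⊆S (initial v∈B) v∉S = contradiction (B⊆S v∈B) v∉S
  forcingStep {S = S} B⊆S (force {u} {v} u-blue uv others) v∉S with u ∈? S
  ... | no u∉S = forcingStep B⊆S u-blue u∉S
  ... | yes u∈S with any? (λ w → ¬? (w ∈? S) ×-dec (adj H u w Bool.≟ true) ×-dec ¬? (w Fin.≟ v))
  ...   | yes (w , w∉S , uw , w≢v) = forcingStep B⊆S (others w uw w≢v) w∉S
  ...   | no none = record
    { forcer = u ; forced = v ; forcer∈S = u∈S ; forced∉S = v∉S ; forcer-adj-forced = uv
    ; others∈S = λ {w} uw w≢v →
        decidable-stable (w ∈? S) (λ w∉S → none (w , w∉S , uw , w≢v))
    }

  -- The last field is the invariant that keeps the forcers distinct.
  record Forcers (S : Subset n) (r : ℕ) : Set where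
    field
      blue : Subset n
      S⊆blue : S ⊆ blue
      ∣blue∣≤ : ∣ blue ∣ ≤ ∣ S ∣ + r
      forcer : Fin r → Fin n
      forcer-injective : Injective _≡_ _≡_ forcer
      forcer∈blue : ∀ i → forcer i ∈ blue
      neighbours∈blue : ∀ i {w} → adj H (forcer i) w ≡ true → w ∈ blue
      neighbour∉S : ∀ i → ∃ λ w → adj H (forcer i) w ≡ true × w ∉ S

  noForcers : ∀ {S} → Forcers S 0
  noForcers {S} = record
    { blue = S ; S⊆blue = ⊆-refl ; ∣blue∣≤ = ℕ.≤-reflexive (sym (ℕ.+-identityʳ ∣ S ∣))
    ; forcer = λ () ; forcer-injective = λ { {()} } ; forcer∈blue = λ ()
    ; neighbours∈blue = λ () ; neighbour∉S = λ ()
    }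

  prepend : ∀ {S r} (step : ForcingStep S) →
    Forcers (S ∪ ⁅ ForcingStep.forced step ⁆) r → Forcers S (suc r)
  prepend {S} {r} step F = record
    { blue = blue ; S⊆blue = S⊆blue ∘ S⊆S′ ; ∣blue∣≤ = ∣blue∣≤′
    ; forcer = forcer′ ; forcer-injective = forcer′-injective ; forcer∈blue = forcer′∈blue
    ; neighbours∈blue = neighbours′∈blue ; neighbour∉S = neighbour′∉S
    }
    where
    open ForcingStep step renaming (forcer to u; forced to v)
    open Forcers F
    S′ = S ∪ ⁅ v ⁆

    S⊆S′ : S ⊆ S′
    S⊆S′ = p⊆p∪q ⁅ v ⁆

    u-neighbours∈S′ : ∀ {w} → adj H u w ≡ true → w ∈ S′
    u-neighbours∈S′ {w} uw with w Fin.≟ v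
    ... | yes refl = q⊆p∪q S ⁅ v ⁆ (x∈⁅x⁆ v)
    ... | no w≢v = S⊆S′ (others∈S uw w≢v)

    ∣blue∣≤′ : ∣ blue ∣ ≤ ∣ S ∣ + suc r
    ∣blue∣≤′ = ℕ.≤-trans ∣blue∣≤
      (ℕ.≤-trans (ℕ.+-monoˡ-≤ r (∣p∪⁅x⁆∣≤∣p∣+1 S v)) (ℕ.≤-reflexive (ℕ.+-assoc ∣ S ∣ 1 r)))

    forcer′ : Fin (suc r) → Fin n
    forcer′ zero    = u
    forcer′ (suc i) = forcer i

    u≢forcer : ∀ i → u ≢ forcer i
    u≢forcer i u≡forcer with neighbour∉S i
    ... | w , forcer-w , w∉S′ =
      w∉S′ (u-neighbours∈S′ (subst (λ x → adj H x w ≡ true) (sym u≡forcer) forcer-w))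

    forcer′-injective : Injective _≡_ _≡_ forcer′
    forcer′-injective {zero}  {zero}  _  = refl
    forcer′-injective {zero}  {suc j} eq = contradiction eq (u≢forcer j)
    forcer′-injective {suc i} {zero}  eq = contradiction (sym eq) (u≢forcer i)
    forcer′-injective {suc i} {suc j} eq = cong suc (forcer-injective eq)

    forcer′∈blue : ∀ i → forcer′ i ∈ blue
    forcer′∈blue zero    = S⊆blue (S⊆S′ forcer∈S)
    forcer′∈blue (suc i) = forcer∈blue i

    neighbours′∈blue : ∀ i {w} → adj H (forcer′ i) w ≡ true → w ∈ blue
    neighbours′∈blue zero    = S⊆blue ∘ u-neighbours∈S′
    neighbours′∈blue (suc i) = neighbours∈blue i

    neighbour′∉S : ∀ i → ∃ λ w → adj H (forcer′ i) w ≡ true × w ∉ S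
    neighbour′∉S zero = v , forcer-adj-forced , forced∉S
    neighbour′∉S (suc i) with neighbour∉S i
    ... | w , forcer-w , w∉S′ = w , forcer-w , w∉S′ ∘ S⊆S′

  forcers : ∀ {B} → IsZeroForcingSet H B → ∀ r {S} → B ⊆ S → ∣ S ∣ + r ≤ n → Forcers S r
  forcers zfs zero    _   _     = noForcers
  forcers zfs (suc r) {S} B⊆S bound = prepend step (forcers zfs r (S⊆S′ ∘ B⊆S) bound′)
    where
    white : Σ (Fin (suc r) → Fin n) λ g → Injective _≡_ _≡_ g × (∀ j → g j ∉ S)
    white = injectionOutside S bound

    step : ForcingStep S
    step with white
    ... | g , _ , g∉S = forcingStep B⊆S (zfs (g zero)) (g∉S zero)

    S′ = S ∪ ⁅ ForcingStep.forced step ⁆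

    S⊆S′ : S ⊆ S′
    S⊆S′ = p⊆p∪q _

    bound′ : ∣ S′ ∣ + r ≤ n
    bound′ = ℕ.≤-trans (ℕ.+-monoˡ-≤ r (∣p∪⁅x⁆∣≤∣p∣+1 S (ForcingStep.forced step)))
               (ℕ.≤-trans (ℕ.≤-reflexive (ℕ.+-assoc ∣ S ∣ 1 r)) bound)

complement-nonadj⇒adj : ∀ {n} (G : Graph n) {u w} →
  u ≢ w → adj (complement G) u w ≡ false → adj G u w ≡ true
complement-nonadj⇒adj G {u} {w} u≢w nonadj with u Fin.≟ w
... | yes u≡w = contradiction u≡w u≢w
... | no _ with adj G u w
...   | true  = refl
...   | false = contradiction nonadj λ ()

containsKrs : ∀ {n} (G : Graph n) {S r s} (F : Forcers (complement G) S r) →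
  ∣ Forcers.blue F ∣ + s ≤ n → ContainsKrs G r s
containsKrs G F bound with injectionOutside (Forcers.blue F) bound
... | g , g-injective , g∉blue =
  forcer , g , forcer-injective , g-injective , forcer≢g ,
  λ i j → complement-nonadj⇒adj G (forcer≢g i j)
            (¬-not λ adjᶜ → g∉blue j (neighbours∈blue i adjᶜ))
  where
  open Forcers F
  forcer≢g : ∀ i j → forcer i ≢ g j
  forcer≢g i j eq = g∉blue j (subst (_∈ blue) eq (forcer∈blue i))

m<n∸r∸s+1⇒m+r+s≤n : ∀ {m n} r s → r + s ≤ n → m < n ∸ r ∸ s + 1 → m + r + s ≤ n
m<n∸r∸s+1⇒m+r+s≤n {m} {n} r s r+s≤n m< = begin
  m + r + s   ≡⟨ ℕ.+-assoc m r s ⟩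
  m + (r + s) ≤⟨ ℕ.m≤o∸n⇒m+n≤o m r+s≤n m≤ ⟩
  n           ∎
  where
  open ℕ.≤-Reasoning
  m≤ : m ≤ n ∸ (r + s)
  m≤ = subst (m ≤_) (ℕ.∸-+-assoc n r s)
         (ℕ.m<1+n⇒m≤n (subst (m <_) (ℕ.+-comm (n ∸ r ∸ s) 1) m<))

theorem2p1 : (n : ℕ) (G : Graph n) (r s : ℕ) → r + s ≤ n →
    ¬ ContainsKrs G r s →
    ZeroForcingNumber≥ (complement G) (n ∸ r ∸ s + 1)
theorem2p1 n G r s r+s≤n noKrs B zfs = ℕ.≮⇒≥ λ small →
  let bound = m<n∸r∸s+1⇒m+r+s≤n r s r+s≤n small
      F = forcers (complement G) zfs r ⊆-refl (ℕ.m+n≤o⇒m≤o (∣ B ∣ + r) bound)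
  in noKrs (containsKrs G F (ℕ.≤-trans (ℕ.+-monoˡ-≤ s (Forcers.∣blue∣≤ F)) bound))
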